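{- For each of the skew shapes $\lambda/\mu\in\{(3,2)/(1),\ (2,2,1)/(1),\ (3,2,1)/(2),\ (3,2,2)/(2,1),\ (2,2,1,1)/(1,1)\}$, the polytope $\mathcal{P}_{\lambda/\mu,\mathbf{1}}$ is non-integral, where $\mathbf{1}=(1,\dots,1)$ has $|\lambda|-|\mu|$ parts.
   Context: For a composition $\mathbf{w}=(w_1,\dots,w_{m-1})$ of positive integers, a Gelfand--Tsetlin pattern is a real array $(x^i_j)_{1\le i\le m,\,1\le j\le n}$ ($n$ at least the length of $\lambda$, partitions padded with zeros) with $x^{i+1}_j\ge x^i_j$ and $x^i_j\ge x^{i+1}_{j+1}$ whenever defined; $\mathcal{P}_{\lambda/\mu,\mathbf{w}}\subset\mathbb{R}^{mn}$ is the polytope of such patterns with $\mathbf{x}^m=\lambda$, $\mathbf{x}^1=\mu$, and $\sum_jx^{i+1}_j-\sum_jx^i_j=w_i$ for all $i$. A polytope is non-integral if some vertex is not a lattice point.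
   Formalization: The Gelfand–Tsetlin patterns, both the vertex and the patterns against which its extremality is tested, have rational entries instead of real ones. -}

module Defs where

open import Data.Nat as ℕ using (ℕ; zero; suc; _∸_)
open import Data.Integer using (ℤ; +_)
open import Data.Rational using (ℚ; _+_; _-_; _*_; _≤_; _<_; 0ℚ; 1ℚ; _/_)
open import Data.Fin using (Fin; zero; suc; toℕ; inject₁; fromℕ)
open import Data.List using (List; []; _∷_; length)
open import Data.Nat.ListAction using (sum)
open import Data.Product using (Σ; ∃; _×_; _,_)
open import Relation.Binary.PropositionalEquality using (_≡_)
open import Relation.Nullary using (¬_)

ℕ→ℚ : ℕ → ℚ
ℕ→ℚ k = + k / 1

ℤ→ℚ : ℤ → ℚ
ℤ→ℚ z = z / 1

Σℚ : (n : ℕ) → (Fin n → ℚ) → ℚ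
Σℚ zero    f = 0ℚ
Σℚ (suc n) f = f zero + Σℚ n (λ j → f (suc j))

pad : List ℕ → (n : ℕ) → Fin n → ℚ
pad []       n       j       = 0ℚ
pad (p ∷ ps) zero    ()
pad (p ∷ ps) (suc n) zero    = ℕ→ℚ p
pad (p ∷ ps) (suc n) (suc j) = pad ps n j

-- Points of ℚ^{mn}, m = suc k rows (row index i ↦ x^{i+1}), n columns
Point : ℕ → ℕ → Set
Point k n = Fin (suc k) → Fin n → ℚ

-- Gelfand–Tsetlin polytope P_{λ/μ,w} with w = (w_1,…,w_k), m = k+1,
-- as a predicate on points; λ and μ are given padded to length n.
GTPoly : (k n : ℕ) (lam mu : Fin n → ℚ) (w : Fin k → ℕ) → Point k n → Set
GTPoly k n lam mu w x =
    (∀ (i : Fin k) (j : Fin n) → x (inject₁ i) j ≤ x (suc i) j)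
  × (∀ (i : Fin k) (j j' : Fin n) → toℕ j' ≡ suc (toℕ j) → x (suc i) j' ≤ x (inject₁ i) j)
  × (∀ j → x (fromℕ k) j ≡ lam j)
  × (∀ j → x zero j ≡ mu j)
  × (∀ (i : Fin k) → Σℚ n (x (suc i)) - Σℚ n (x (inject₁ i)) ≡ ℕ→ℚ (w i))

-- vertex = extreme point: not a proper convex combination of two distinct points of P
IsVertex : {k n : ℕ} → (Point k n → Set) → Point k n → Set
IsVertex {k} {n} P x =
  P x × (∀ (y z : Point k n) (t : ℚ) → P y → P z → 0ℚ < t → t < 1ℚ →
           (∀ i j → x i j ≡ t * y i j + (1ℚ - t) * z i j) →
           ∀ i j → y i j ≡ z i j)

IsLatticePoint : {k n : ℕ} → Point k n → Set
IsLatticePoint {k} {n} x = ∀ i j → ∃ λ (z : ℤ) → x i j ≡ ℤ→ℚ z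

NonIntegral : {k n : ℕ} → (Point k n → Set) → Set
NonIntegral {k} {n} P = ∃ λ (x : Point k n) → IsVertex P x × ¬ IsLatticePoint x

P-skew-ones : (lam mu : List ℕ) →
  Point (sum lam ∸ sum mu) (length lam) → Set
P-skew-ones lam mu =
  GTPoly (sum lam ∸ sum mu) (length lam) (pad lam (length lam)) (pad mu (length lam)) (λ _ → 1)

-- A point x of the polytope is a vertex as soon as the constraints tight at x determine it:
-- if x = t y + (1 - t) z with y, z in the polytope and 0 < t < 1, every inequality tight at x
-- is tight at y and at z, so d = y - z vanishes on the fixed rows μ and λ, has zero row sums
-- and satisfies the inequalities tight at x as equations.  For each shape we exhibit a
-- half-integral point x of the polytope for which these equations force d = 0, by
-- propagating zeros along tight inequalities and through row sums.  In every case two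
-- entries of the middle row are tied to each other by tight inequalities through the row
-- below, so its row sum fixes only twice their common value; this is where the half-integer
-- entries of x come from.

{-# OPTIONS --safe #-}
module Submission where

open import Defs
open import Data.Nat as ℕ using (ℕ; zero; suc; _∸_)
open import Data.Integer as ℤ using (ℤ)
open import Data.Rational
  using (ℚ; _+_; _-_; _*_; -_; _≤_; _<_; _≤?_; _≟_; 0ℚ; 1ℚ; _/_; ↧ₙ_; positive; Positive; NonNegative)
open import Data.Rational.Properties
open import Data.Rational.Solver using (module +-*-Solver)
open import Data.Nat.Coprimality as Coprime using (1-coprimeTo)
open import Data.Fin using (Fin; zero; suc; toℕ; inject₁; fromℕ)
open import Data.Fin.Patterns using (0F; 1F; 2F; 3F; 4F)
open import Data.Fin.Properties using (all?)
open import Data.Fin.Induction using (<-weakInduction)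
open import Data.Vec using (Vec; []; _∷_; lookup)
open import Data.List using ([]; _∷_; length)
open import Data.Nat.ListAction using (sum)
open import Data.Product using (_×_; _,_; proj₁; proj₂)
open import Data.Sum as Sum using (_⊎_; inj₁; inj₂; [_,_])
open import Data.Empty using (⊥-elim)
open import Function using (_∘_)
open import Relation.Binary.Definitions using (tri<; tri≈; tri>)
open import Relation.Binary.PropositionalEquality
  using (_≡_; _≢_; refl; sym; trans; cong; cong₂; subst; module ≡-Reasoning)
open import Relation.Nullary.Decidable using (_×-dec_; _→-dec_; True; toWitness)
open import Relation.Unary using (Decidable)
open import Algebra.Properties.Group +-0-group using (x∙y⁻¹≈ε⇒x≈y; x≈y⇒x∙y⁻¹≈ε; ∙-cancelʳ)

Σℚ-cong : ∀ n {f g : Fin n → ℚ} → (∀ j → f j ≡ g j) → Σℚ n f ≡ Σℚ n g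
Σℚ-cong zero    f≗g = refl
Σℚ-cong (suc n) f≗g = cong₂ _+_ (f≗g 0F) (Σℚ-cong n (f≗g ∘ suc))

Σℚ-neg : ∀ n (f : Fin n → ℚ) → Σℚ n (-_ ∘ f) ≡ - Σℚ n f
Σℚ-neg zero    f = refl
Σℚ-neg (suc n) f =
  trans (cong ((- f 0F) +_) (Σℚ-neg n (f ∘ suc))) (sym (neg-distrib-+ (f 0F) (Σℚ n (f ∘ suc))))

Σℚ-diff : ∀ n (f g : Fin n → ℚ) → Σℚ n (λ j → f j - g j) ≡ Σℚ n f - Σℚ n g
Σℚ-diff zero    f g = refl
Σℚ-diff (suc n) f g = begin
  (f 0F - g 0F) + Σℚ n (λ j → f (suc j) - g (suc j))
    ≡⟨ cong ((f 0F - g 0F) +_) (Σℚ-diff n (f ∘ suc) (g ∘ suc)) ⟩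
  (f 0F - g 0F) + (Σℚ n (f ∘ suc) - Σℚ n (g ∘ suc))
    ≡⟨ interchange (f 0F) (g 0F) (Σℚ n (f ∘ suc)) (Σℚ n (g ∘ suc)) ⟩
  (f 0F + Σℚ n (f ∘ suc)) - (g 0F + Σℚ n (g ∘ suc)) ∎
  where
  open ≡-Reasoning
  open +-*-Solver
  interchange : ∀ a b c e → (a - b) + (c - e) ≡ (a + c) - (b + e)
  interchange = solve 4 (λ a b c e → (a :- b) :+ (c :- e) := (a :+ c) :- (b :+ e)) refl

Σℚ-nonNeg : ∀ n (f : Fin n → ℚ) → (∀ j → 0ℚ ≤ f j) → 0ℚ ≤ Σℚ n f
Σℚ-nonNeg zero    f 0≤f = ≤-refl
Σℚ-nonNeg (suc n) f 0≤f = +-mono-≤ (0≤f 0F) (Σℚ-nonNeg n (f ∘ suc) (0≤f ∘ suc))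

Σℚ-pos : ∀ n (f : Fin n → ℚ) j₀ → (∀ j → 0ℚ ≤ f j) → 0ℚ < f j₀ → 0ℚ < Σℚ n f
Σℚ-pos (suc n) f 0F       0≤f 0<f₀ = +-mono-<-≤ 0<f₀ (Σℚ-nonNeg n (f ∘ suc) (0≤f ∘ suc))
Σℚ-pos (suc n) f (suc j₀) 0≤f 0<f₀ = +-mono-≤-< (0≤f 0F) (Σℚ-pos n (f ∘ suc) j₀ (0≤f ∘ suc) 0<f₀)

twoValued-pos⇒Σℚ-pos : ∀ n (f : Fin n → ℚ) j₀ →
  (∀ j → f j ≡ 0ℚ ⊎ f j ≡ f j₀) → 0ℚ < f j₀ → 0ℚ < Σℚ n f
twoValued-pos⇒Σℚ-pos n f j₀ split 0<f₀ = Σℚ-pos n f j₀ 0≤f 0<f₀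
  where
  0≤f : ∀ j → 0ℚ ≤ f j
  0≤f j = [ ≤-reflexive ∘ sym , (λ e → subst (0ℚ ≤_) (sym e) (<⇒≤ 0<f₀)) ] (split j)

twoValued-Σℚ≡0⇒≡0 : ∀ n (f : Fin n → ℚ) j₀ →
  (∀ j → f j ≡ 0ℚ ⊎ f j ≡ f j₀) → Σℚ n f ≡ 0ℚ → f j₀ ≡ 0ℚ
twoValued-Σℚ≡0⇒≡0 n f j₀ split Σf≡0 with <-cmp (f j₀) 0ℚ
... | tri< f₀<0 _ _ =
  ⊥-elim (<-irrefl (sym Σ-f≡0) (twoValued-pos⇒Σℚ-pos n (-_ ∘ f) j₀ split-f (neg-antimono-< f₀<0)))
  where
  split-f : ∀ j → - f j ≡ 0ℚ ⊎ - f j ≡ - f j₀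
  split-f j = Sum.map (cong (-_)) (cong (-_)) (split j)
  Σ-f≡0 : Σℚ n (-_ ∘ f) ≡ 0ℚ
  Σ-f≡0 = trans (Σℚ-neg n f) (cong (-_) Σf≡0)
... | tri≈ _ f₀≡0 _ = f₀≡0
... | tri> _ _ 0<f₀ = ⊥-elim (<-irrefl (sym Σf≡0) (twoValued-pos⇒Σℚ-pos n f j₀ split 0<f₀))

convex-combination-tight : ∀ {t a b a′ b′} → 0ℚ < t → t < 1ℚ → a ≤ b → a′ ≤ b′ →
  t * a + (1ℚ - t) * a′ ≡ t * b + (1ℚ - t) * b′ → a ≡ b × a′ ≡ b′
convex-combination-tight {t} {a} {b} {a′} {b′} 0<t t<1 a≤b a′≤b′ eq =
    ≤-antisym a≤b (≮⇒≥ λ a<b →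
      <-irrefl eq (+-mono-<-≤ (*-monoʳ-<-pos t a<b) (*-monoˡ-≤-nonNeg (1ℚ - t) a′≤b′)))
  , ≤-antisym a′≤b′ (≮⇒≥ λ a′<b′ →
      <-irrefl eq (+-mono-≤-< (*-monoˡ-≤-nonNeg t a≤b) (*-monoʳ-<-pos (1ℚ - t) a′<b′)))
  where
  instance
    t-pos : Positive t
    t-pos = positive 0<t
    1-t-pos : Positive (1ℚ - t)
    1-t-pos = positive (subst (_< 1ℚ - t) (+-inverseʳ t) (+-monoˡ-< (- t) t<1))
    1-t-nonNeg : NonNegative (1ℚ - t)
    1-t-nonNeg = pos⇒nonNeg (1ℚ - t)
    t-nonNeg : NonNegative t
    t-nonNeg = pos⇒nonNeg t

↧ₙ-ℤ→ℚ : ∀ z → ↧ₙ (ℤ→ℚ z) ≡ 1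
↧ₙ-ℤ→ℚ (ℤ.+ m)    = cong ↧ₙ_ (normalize-coprime (Coprime.sym (1-coprimeTo m)))
↧ₙ-ℤ→ℚ ℤ.-[1+ m ] = cong (↧ₙ_ ∘ -_) (normalize-coprime (Coprime.sym (1-coprimeTo (suc m))))

gtPoly? : ∀ k n lam mu w → Decidable (GTPoly k n lam mu w)
gtPoly? k n lam mu w x =
        all? (λ i → all? λ j → x (inject₁ i) j ≤? x (suc i) j)
  ×-dec all? (λ i → all? λ j → all? λ j′ →
          (toℕ j′ ℕ.≟ suc (toℕ j)) →-dec (x (suc i) j′ ≤? x (inject₁ i) j))
  ×-dec all? (λ j → x (fromℕ k) j ≟ lam j)
  ×-dec all? (λ j → x zero j ≟ mu j)
  ×-dec all? (λ i → Σℚ n (x (suc i)) - Σℚ n (x (inject₁ i)) ≟ ℕ→ℚ (w i))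

record TightAt {k n : ℕ} (x p : Point k n) : Set where
  field
    vertical : ∀ i j → x (inject₁ i) j ≡ x (suc i) j → p (inject₁ i) j ≡ p (suc i) j
    diagonal : ∀ i j j′ → toℕ j′ ≡ suc (toℕ j) →
               x (suc i) j′ ≡ x (inject₁ i) j → p (suc i) j′ ≡ p (inject₁ i) j

-- Differences of two points of the polytope at which all inequalities tight at x are tight.
record TightDirection {k n : ℕ} (x d : Point k n) : Set where
  field
    bottom : ∀ j → d zero j ≡ 0ℚ
    top    : ∀ j → d (fromℕ k) j ≡ 0ℚ
    rowSum : ∀ i → Σℚ n (d i) ≡ 0ℚ
    tight  : TightAt x d

Rigid : ∀ {k n} → Point k n → Set
Rigid x = ∀ d → TightDirection x d → ∀ i j → d i j ≡ 0ℚ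

module Propagation {k n : ℕ} {x d : Point k n} (δ : TightDirection x d) where
  open TightDirection δ public
  open TightAt tight public

  row-vanishes : ∀ i j₀ → (∀ j → d i j ≡ 0ℚ ⊎ d i j ≡ d i j₀) → d i j₀ ≡ 0ℚ
  row-vanishes i j₀ split = twoValued-Σℚ≡0⇒≡0 n (d i) j₀ split (rowSum i)

_-ᵖ_ : ∀ {k n} → Point k n → Point k n → Point k n
(y -ᵖ z) i j = y i j - z i j

module _ {k n : ℕ} {lam mu : Fin n → ℚ} {w : Fin k → ℕ} where

  private
    GT : Point k n → Set
    GT = GTPoly k n lam mu w

  rowSums-agree : ∀ {y z} → GT y → GT z → ∀ i → Σℚ n (y i) ≡ Σℚ n (z i)
  rowSums-agree {y} {z} (_ , _ , _ , y-bottom , y-steps) (_ , _ , _ , z-bottom , z-steps) =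
    <-weakInduction (λ i → Σℚ n (y i) ≡ Σℚ n (z i)) bottom-agrees step
    where
    bottom-agrees : Σℚ n (y zero) ≡ Σℚ n (z zero)
    bottom-agrees = Σℚ-cong n λ j → trans (y-bottom j) (sym (z-bottom j))
    step : ∀ i → Σℚ n (y (inject₁ i)) ≡ Σℚ n (z (inject₁ i)) →
           Σℚ n (y (suc i)) ≡ Σℚ n (z (suc i))
    step i agrees = ∙-cancelʳ (- Σℚ n (z (inject₁ i))) _ _ (begin
      Σℚ n (y (suc i)) - Σℚ n (z (inject₁ i)) ≡⟨ cong (_-_ (Σℚ n (y (suc i)))) (sym agrees) ⟩
      Σℚ n (y (suc i)) - Σℚ n (y (inject₁ i)) ≡⟨ y-steps i ⟩
      ℕ→ℚ (w i)                               ≡⟨ sym (z-steps i) ⟩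
      Σℚ n (z (suc i)) - Σℚ n (z (inject₁ i)) ∎)
      where open ≡-Reasoning

  tightAt-endpoints : ∀ {x y z t} → GT y → GT z → 0ℚ < t → t < 1ℚ →
    (∀ i j → x i j ≡ t * y i j + (1ℚ - t) * z i j) → TightAt x y × TightAt x z
  tightAt-endpoints {x} {y} {z} (y-up , y-diag , _) (z-up , z-diag , _) 0<t t<1 x≡ =
      record { vertical = λ i j → proj₁ ∘ vertical-both i j
             ; diagonal = λ i j j′ j′≡ → proj₁ ∘ diagonal-both i j j′ j′≡ }
    , record { vertical = λ i j → proj₂ ∘ vertical-both i j
             ; diagonal = λ i j j′ j′≡ → proj₂ ∘ diagonal-both i j j′ j′≡ }
    where
    vertical-both : ∀ i j → x (inject₁ i) j ≡ x (suc i) j →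
      y (inject₁ i) j ≡ y (suc i) j × z (inject₁ i) j ≡ z (suc i) j
    vertical-both i j tight = convex-combination-tight 0<t t<1 (y-up i j) (z-up i j)
      (trans (sym (x≡ (inject₁ i) j)) (trans tight (x≡ (suc i) j)))
    diagonal-both : ∀ i j j′ → toℕ j′ ≡ suc (toℕ j) → x (suc i) j′ ≡ x (inject₁ i) j →
      y (suc i) j′ ≡ y (inject₁ i) j × z (suc i) j′ ≡ z (inject₁ i) j
    diagonal-both i j j′ j′≡ tight = convex-combination-tight 0<t t<1
      (y-diag i j j′ j′≡) (z-diag i j j′ j′≡)
      (trans (sym (x≡ (suc i) j′)) (trans tight (x≡ (inject₁ i) j)))

  difference-tightDirection : ∀ {x y z} → GT y → GT z → TightAt x y → TightAt x z →
    TightDirection x (y -ᵖ z)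
  difference-tightDirection {x} {y} {z}
    y∈P@(_ , _ , y-top , y-bottom , _) z∈P@(_ , _ , z-top , z-bottom , _) Ty Tz = record
    { bottom = λ j → x≈y⇒x∙y⁻¹≈ε (trans (y-bottom j) (sym (z-bottom j)))
    ; top    = λ j → x≈y⇒x∙y⁻¹≈ε (trans (y-top j) (sym (z-top j)))
    ; rowSum = λ i → trans (Σℚ-diff n (y i) (z i)) (x≈y⇒x∙y⁻¹≈ε (rowSums-agree y∈P z∈P i))
    ; tight  = record
      { vertical = λ i j e → cong₂ _-_ (Ty.vertical i j e) (Tz.vertical i j e)
      ; diagonal = λ i j j′ j′≡ e →
          cong₂ _-_ (Ty.diagonal i j j′ j′≡ e) (Tz.diagonal i j j′ j′≡ e)
      }
    }
    where
    module Ty = TightAt Ty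
    module Tz = TightAt Tz

  rigid⇒vertex : ∀ {x} → GT x → Rigid x → IsVertex GT x
  rigid⇒vertex x∈P rigid = x∈P , λ y z t y∈P z∈P 0<t t<1 x≡ i j →
    let Ty , Tz = tightAt-endpoints y∈P z∈P 0<t t<1 x≡
    in x∙y⁻¹≈ε⇒x≈y _ _ (rigid (y -ᵖ z) (difference-tightDirection y∈P z∈P Ty Tz) i j)

  rigid∧non-integer⇒nonIntegral : ∀ {x} → GT x → Rigid x →
    ∀ i j → ↧ₙ (x i j) ≢ 1 → NonIntegral GT
  rigid∧non-integer⇒nonIntegral {x} x∈P rigid i j ↧x≢1 =
    x , rigid⇒vertex x∈P rigid , λ lattice →
      let z , x≡z = lattice i j in ↧x≢1 (trans (cong ↧ₙ_ x≡z) (↧ₙ-ℤ→ℚ z))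

nonIntegral-skewOnes : ∀ lam mu (x : Point (sum lam ∸ sum mu) (length lam)) →
  {True (gtPoly? _ _ (pad lam (length lam)) (pad mu (length lam)) (λ _ → 1) x)} →
  Rigid x → ∀ i j → ↧ₙ (x i j) ≢ 1 → NonIntegral (P-skew-ones lam mu)
nonIntegral-skewOnes lam mu x {x∈P} =
  rigid∧non-integer⇒nonIntegral {w = λ _ → 1} (toWitness x∈P)

-- Rows are listed from x¹ = μ up to xᵐ = λ.
halves : ∀ {k n} → Vec (Vec ℕ n) (suc k) → Point k n
halves rows i j = ℤ.+ (lookup (lookup rows i) j) / 2

x₁ : Point 4 2
x₁ = halves ((2 ∷ 0 ∷ []) ∷ (3 ∷ 1 ∷ []) ∷ (3 ∷ 3 ∷ []) ∷ (5 ∷ 3 ∷ []) ∷ (6 ∷ 4 ∷ []) ∷ [])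

rigid₁ : Rigid x₁
rigid₁ d δ = entry
  where
  open Propagation δ
  d21≡d20 : d 2F 1F ≡ d 2F 0F
  d21≡d20 = trans (diagonal 1F 0F 1F refl refl) (vertical 1F 0F refl)
  d20 : d 2F 0F ≡ 0ℚ
  d20 = row-vanishes 2F 0F λ { 0F → inj₂ refl ; 1F → inj₂ d21≡d20 }
  d21 : d 2F 1F ≡ 0ℚ
  d21 = trans d21≡d20 d20
  d10 : d 1F 0F ≡ 0ℚ
  d10 = trans (vertical 1F 0F refl) d20
  d31 : d 3F 1F ≡ 0ℚ
  d31 = trans (diagonal 2F 0F 1F refl refl) d20
  d11 : d 1F 1F ≡ 0ℚ
  d11 = row-vanishes 1F 1F λ { 0F → inj₁ d10 ; 1F → inj₂ refl }
  d30 : d 3F 0F ≡ 0ℚ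
  d30 = row-vanishes 3F 0F λ { 0F → inj₂ refl ; 1F → inj₁ d31 }
  entry : ∀ i j → d i j ≡ 0ℚ
  entry 0F = bottom
  entry 1F = λ { 0F → d10 ; 1F → d11 }
  entry 2F = λ { 0F → d20 ; 1F → d21 }
  entry 3F = λ { 0F → d30 ; 1F → d31 }
  entry 4F = top

x₂ : Point 4 3
x₂ = halves ( (2 ∷ 0 ∷ 0 ∷ []) ∷ (3 ∷ 1 ∷ 0 ∷ []) ∷ (3 ∷ 3 ∷ 0 ∷ [])
            ∷ (4 ∷ 3 ∷ 1 ∷ []) ∷ (4 ∷ 4 ∷ 2 ∷ []) ∷ [])

rigid₂ : Rigid x₂
rigid₂ d δ = entry
  where
  open Propagation δ
  d12 : d 1F 2F ≡ 0ℚ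
  d12 = trans (diagonal 0F 1F 2F refl refl) (bottom 1F)
  d22 : d 2F 2F ≡ 0ℚ
  d22 = trans (sym (vertical 1F 2F refl)) d12
  d30 : d 3F 0F ≡ 0ℚ
  d30 = trans (vertical 3F 0F refl) (top 0F)
  d21≡d20 : d 2F 1F ≡ d 2F 0F
  d21≡d20 = trans (diagonal 1F 0F 1F refl refl) (vertical 1F 0F refl)
  d20 : d 2F 0F ≡ 0ℚ
  d20 = row-vanishes 2F 0F λ { 0F → inj₂ refl ; 1F → inj₂ d21≡d20 ; 2F → inj₁ d22 }
  d21 : d 2F 1F ≡ 0ℚ
  d21 = trans d21≡d20 d20
  d10 : d 1F 0F ≡ 0ℚ
  d10 = trans (vertical 1F 0F refl) d20
  d31 : d 3F 1F ≡ 0ℚ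
  d31 = trans (diagonal 2F 0F 1F refl refl) d20
  d11 : d 1F 1F ≡ 0ℚ
  d11 = row-vanishes 1F 1F λ { 0F → inj₁ d10 ; 1F → inj₂ refl ; 2F → inj₁ d12 }
  d32 : d 3F 2F ≡ 0ℚ
  d32 = row-vanishes 3F 2F λ { 0F → inj₁ d30 ; 1F → inj₁ d31 ; 2F → inj₂ refl }
  entry : ∀ i j → d i j ≡ 0ℚ
  entry 0F = bottom
  entry 1F = λ { 0F → d10 ; 1F → d11 ; 2F → d12 }
  entry 2F = λ { 0F → d20 ; 1F → d21 ; 2F → d22 }
  entry 3F = λ { 0F → d30 ; 1F → d31 ; 2F → d32 }
  entry 4F = top

x₃ : Point 4 3
x₃ = halves ( (4 ∷ 0 ∷ 0 ∷ []) ∷ (5 ∷ 1 ∷ 0 ∷ []) ∷ (6 ∷ 1 ∷ 1 ∷ [])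
            ∷ (6 ∷ 3 ∷ 1 ∷ []) ∷ (6 ∷ 4 ∷ 2 ∷ []) ∷ [])

rigid₃ : Rigid x₃
rigid₃ d δ = entry
  where
  open Propagation δ
  d12 : d 1F 2F ≡ 0ℚ
  d12 = trans (diagonal 0F 1F 2F refl refl) (bottom 1F)
  d30 : d 3F 0F ≡ 0ℚ
  d30 = trans (vertical 3F 0F refl) (top 0F)
  d20 : d 2F 0F ≡ 0ℚ
  d20 = trans (vertical 2F 0F refl) d30
  d22≡d21 : d 2F 2F ≡ d 2F 1F
  d22≡d21 = trans (diagonal 1F 1F 2F refl refl) (vertical 1F 1F refl)
  d21 : d 2F 1F ≡ 0ℚ
  d21 = row-vanishes 2F 1F λ { 0F → inj₁ d20 ; 1F → inj₂ refl ; 2F → inj₂ d22≡d21 }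
  d22 : d 2F 2F ≡ 0ℚ
  d22 = trans d22≡d21 d21
  d11 : d 1F 1F ≡ 0ℚ
  d11 = trans (vertical 1F 1F refl) d21
  d32 : d 3F 2F ≡ 0ℚ
  d32 = trans (diagonal 2F 1F 2F refl refl) d21
  d10 : d 1F 0F ≡ 0ℚ
  d10 = row-vanishes 1F 0F λ { 0F → inj₂ refl ; 1F → inj₁ d11 ; 2F → inj₁ d12 }
  d31 : d 3F 1F ≡ 0ℚ
  d31 = row-vanishes 3F 1F λ { 0F → inj₁ d30 ; 1F → inj₂ refl ; 2F → inj₁ d32 }
  entry : ∀ i j → d i j ≡ 0ℚ
  entry 0F = bottom
  entry 1F = λ { 0F → d10 ; 1F → d11 ; 2F → d12 }
  entry 2F = λ { 0F → d20 ; 1F → d21 ; 2F → d22 }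
  entry 3F = λ { 0F → d30 ; 1F → d31 ; 2F → d32 }
  entry 4F = top

x₄ : Point 4 3
x₄ = halves ( (4 ∷ 2 ∷ 0 ∷ []) ∷ (4 ∷ 3 ∷ 1 ∷ []) ∷ (4 ∷ 3 ∷ 3 ∷ [])
            ∷ (5 ∷ 4 ∷ 3 ∷ []) ∷ (6 ∷ 4 ∷ 4 ∷ []) ∷ [])

rigid₄ : Rigid x₄
rigid₄ d δ = entry
  where
  open Propagation δ
  d10 : d 1F 0F ≡ 0ℚ
  d10 = trans (sym (vertical 0F 0F refl)) (bottom 0F)
  d20 : d 2F 0F ≡ 0ℚ
  d20 = trans (sym (vertical 1F 0F refl)) d10
  d31 : d 3F 1F ≡ 0ℚ
  d31 = trans (diagonal 2F 0F 1F refl refl) d20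
  d22≡d21 : d 2F 2F ≡ d 2F 1F
  d22≡d21 = trans (diagonal 1F 1F 2F refl refl) (vertical 1F 1F refl)
  d21 : d 2F 1F ≡ 0ℚ
  d21 = row-vanishes 2F 1F λ { 0F → inj₁ d20 ; 1F → inj₂ refl ; 2F → inj₂ d22≡d21 }
  d22 : d 2F 2F ≡ 0ℚ
  d22 = trans d22≡d21 d21
  d11 : d 1F 1F ≡ 0ℚ
  d11 = trans (vertical 1F 1F refl) d21
  d32 : d 3F 2F ≡ 0ℚ
  d32 = trans (diagonal 2F 1F 2F refl refl) d21
  d12 : d 1F 2F ≡ 0ℚ
  d12 = row-vanishes 1F 2F λ { 0F → inj₁ d10 ; 1F → inj₁ d11 ; 2F → inj₂ refl }
  d30 : d 3F 0F ≡ 0ℚ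
  d30 = row-vanishes 3F 0F λ { 0F → inj₂ refl ; 1F → inj₁ d31 ; 2F → inj₁ d32 }
  entry : ∀ i j → d i j ≡ 0ℚ
  entry 0F = bottom
  entry 1F = λ { 0F → d10 ; 1F → d11 ; 2F → d12 }
  entry 2F = λ { 0F → d20 ; 1F → d21 ; 2F → d22 }
  entry 3F = λ { 0F → d30 ; 1F → d31 ; 2F → d32 }
  entry 4F = top

x₅ : Point 4 4
x₅ = halves ( (2 ∷ 2 ∷ 0 ∷ 0 ∷ []) ∷ (3 ∷ 2 ∷ 1 ∷ 0 ∷ []) ∷ (3 ∷ 3 ∷ 2 ∷ 0 ∷ [])
            ∷ (4 ∷ 3 ∷ 2 ∷ 1 ∷ []) ∷ (4 ∷ 4 ∷ 2 ∷ 2 ∷ []) ∷ [])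

rigid₅ : Rigid x₅
rigid₅ d δ = entry
  where
  open Propagation δ
  d11 : d 1F 1F ≡ 0ℚ
  d11 = trans (diagonal 0F 0F 1F refl refl) (bottom 0F)
  d13 : d 1F 3F ≡ 0ℚ
  d13 = trans (diagonal 0F 2F 3F refl refl) (bottom 2F)
  d22 : d 2F 2F ≡ 0ℚ
  d22 = trans (diagonal 1F 1F 2F refl refl) d11
  d23 : d 2F 3F ≡ 0ℚ
  d23 = trans (sym (vertical 1F 3F refl)) d13
  d32 : d 3F 2F ≡ 0ℚ
  d32 = trans (sym (vertical 2F 2F refl)) d22
  d30 : d 3F 0F ≡ 0ℚ
  d30 = trans (vertical 3F 0F refl) (top 0F)
  d21≡d20 : d 2F 1F ≡ d 2F 0F
  d21≡d20 = trans (diagonal 1F 0F 1F refl refl) (vertical 1F 0F refl)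
  d20 : d 2F 0F ≡ 0ℚ
  d20 = row-vanishes 2F 0F
    λ { 0F → inj₂ refl ; 1F → inj₂ d21≡d20 ; 2F → inj₁ d22 ; 3F → inj₁ d23 }
  d21 : d 2F 1F ≡ 0ℚ
  d21 = trans d21≡d20 d20
  d10 : d 1F 0F ≡ 0ℚ
  d10 = trans (vertical 1F 0F refl) d20
  d31 : d 3F 1F ≡ 0ℚ
  d31 = trans (diagonal 2F 0F 1F refl refl) d20
  d12 : d 1F 2F ≡ 0ℚ
  d12 = row-vanishes 1F 2F
    λ { 0F → inj₁ d10 ; 1F → inj₁ d11 ; 2F → inj₂ refl ; 3F → inj₁ d13 }
  d33 : d 3F 3F ≡ 0ℚ
  d33 = row-vanishes 3F 3F
    λ { 0F → inj₁ d30 ; 1F → inj₁ d31 ; 2F → inj₁ d32 ; 3F → inj₂ refl }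
  entry : ∀ i j → d i j ≡ 0ℚ
  entry 0F = bottom
  entry 1F = λ { 0F → d10 ; 1F → d11 ; 2F → d12 ; 3F → d13 }
  entry 2F = λ { 0F → d20 ; 1F → d21 ; 2F → d22 ; 3F → d23 }
  entry 3F = λ { 0F → d30 ; 1F → d31 ; 2F → d32 ; 3F → d33 }
  entry 4F = top

mainTheorem14 : NonIntegral (P-skew-ones (3 ∷ 2 ∷ []) (1 ∷ []))
    × NonIntegral (P-skew-ones (2 ∷ 2 ∷ 1 ∷ []) (1 ∷ []))
    × NonIntegral (P-skew-ones (3 ∷ 2 ∷ 1 ∷ []) (2 ∷ []))
    × NonIntegral (P-skew-ones (3 ∷ 2 ∷ 2 ∷ []) (2 ∷ 1 ∷ []))
    × NonIntegral (P-skew-ones (2 ∷ 2 ∷ 1 ∷ 1 ∷ []) (1 ∷ 1 ∷ []))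
mainTheorem14 =
    nonIntegral-skewOnes (3 ∷ 2 ∷ [])         (1 ∷ [])     x₁ rigid₁ 1F 0F (λ ())
  , nonIntegral-skewOnes (2 ∷ 2 ∷ 1 ∷ [])     (1 ∷ [])     x₂ rigid₂ 1F 0F (λ ())
  , nonIntegral-skewOnes (3 ∷ 2 ∷ 1 ∷ [])     (2 ∷ [])     x₃ rigid₃ 1F 0F (λ ())
  , nonIntegral-skewOnes (3 ∷ 2 ∷ 2 ∷ [])     (2 ∷ 1 ∷ []) x₄ rigid₄ 1F 1F (λ ())
  , nonIntegral-skewOnes (2 ∷ 2 ∷ 1 ∷ 1 ∷ []) (1 ∷ 1 ∷ []) x₅ rigid₅ 1F 0F (λ ())
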